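{- Let $T$ be a tree, $H$ a connected graph, $f\colon V(T)\to V(H)$ a function, and $e$ an edge of $T\otimes_f H$. Then $e$ is a pendant connecting edge if and only if $e$ is a cut edge such that the two components of $(T\otimes_f H)-e$ have respective orders $n(H)$ and $n(T\otimes_f H)-n(H)$.
   Context: For graphs $G$ and $H$ and a function $f\colon V(G)\to V(H)$, the Sierpiński product $G\otimes_f H$ is the graph with vertex set $V(G)\times V(H)$ whose edges are: $(g,h)(g,h')$ for every $g\in V(G)$ and every edge $hh'\in E(H)$; and $(g,f(g'))(g',f(g))$ for every edge $gg'\in E(G)$ (the latter are called connecting edges). If $uv$ is a pendant edge of the tree $T$ (i.e.\ one of $u,v$ has degree $1$ in $T$), the connecting edge $(u,f(v))(v,f(u))$ of $T\otimes_f H$ is called a pendant connecting edge. $n(X)$ denotes the number of vertices of a graph $X$; a cut edge is an edge whose removal increases the number of components. -}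

module Defs where

open import Data.Nat using (ℕ; _<_; _≤_)
open import Data.Fin using (Fin)
open import Data.Fin.Properties using (_≟_)
open import Data.Product using (Σ; Σ-syntax; _×_; _,_; proj₁; proj₂)
open import Data.Sum using (_⊎_; inj₁; inj₂)
open import Data.List using (List; []; _∷_; length; _∷ʳ_)
open import Data.List.Membership.Propositional using (_∈_)
open import Data.List.Relation.Unary.Any using (Any)
open import Data.List.Relation.Unary.Unique.Propositional using (Unique)
open import Data.List.Relation.Unary.Linked using (Linked)
open import Data.List.Relation.Unary.AllPairs using (AllPairs)
open import Relation.Nullary using (¬_; Dec; yes; no)
open import Relation.Nullary.Decidable using (_×-dec_; _⊎-dec_; ¬?)
open import Relation.Binary.PropositionalEquality using (_≡_; refl; sym)
open import Function.Bundles using (_⇔_)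

record Graph (V : Set) : Set₁ where
  field
    Adj    : V → V → Set
    adj?   : ∀ u v → Dec (Adj u v)
    symm   : ∀ {u v} → Adj u v → Adj v u
    irrefl : ∀ {u} → ¬ Adj u u
open Graph public

data Reach {V : Set} (G : Graph V) : V → V → Set where
  here : ∀ {u} → Reach G u u
  step : ∀ {u w z} → Adj G u w → Reach G w z → Reach G u z

Connected : {V : Set} → Graph V → Set
Connected G = ∀ u v → Reach G u v

HasCycle : {V : Set} → Graph V → Set
HasCycle {V} G = Σ[ x ∈ V ] Σ[ ys ∈ List V ]
  (2 ≤ length ys × Unique (x ∷ ys) × Linked (Adj G) ((x ∷ ys) ∷ʳ x))

IsTree : {V : Set} → Graph V → Set
IsTree G = Connected G × ¬ HasCycle G

Degree1 : {V : Set} → Graph V → V → Set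
Degree1 {V} G u = Σ[ w ∈ V ] (Adj G u w × (∀ w' → Adj G u w' → w' ≡ w))

module _ {nT nH : ℕ} (T : Graph (Fin nT)) (H : Graph (Fin nH))
         (f : Fin nT → Fin nH) where

  SAdj : Fin nT × Fin nH → Fin nT × Fin nH → Set
  SAdj (g , h) (g' , h') =
    (g ≡ g' × Adj H h h') ⊎ (Adj T g g' × (h ≡ f g' × h' ≡ f g))

  private
    sadj? : ∀ u v → Dec (SAdj u v)
    sadj? (g , h) (g' , h') =
      ((g ≟ g') ×-dec adj? H h h') ⊎-dec (adj? T g g' ×-dec ((h ≟ f g') ×-dec (h' ≟ f g)))

    ssym : ∀ {u v} → SAdj u v → SAdj v u
    ssym (inj₁ (refl , a)) = inj₁ (refl , symm H a)
    ssym (inj₂ (a , refl , refl)) = inj₂ (symm T a , refl , refl)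

    sirr : ∀ {u} → ¬ SAdj u u
    sirr (inj₁ (_ , a)) = irrefl H a
    sirr (inj₂ (a , _)) = irrefl T a

  Sierpinski : Graph (Fin nT × Fin nH)
  Sierpinski = record { Adj = SAdj ; adj? = sadj? ; symm = ssym ; irrefl = sirr }

  PendantConnecting : (x y : Fin nT × Fin nH) → Set
  PendantConnecting x y = Σ[ u ∈ Fin nT ] Σ[ v ∈ Fin nT ]
    (Adj T u v × (Degree1 T u ⊎ Degree1 T v) ×
     ((x ≡ (u , f v) × y ≡ (v , f u)) ⊎ (x ≡ (v , f u) × y ≡ (u , f v))))

SameEdge : {V : Set} → V → V → V → V → Set
SameEdge x y a b = (a ≡ x × b ≡ y) ⊎ (a ≡ y × b ≡ x)

module _ {V : Set} (_≟V_ : ∀ (a b : V) → Dec (a ≡ b)) where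
  removeEdge : Graph V → V → V → Graph V
  removeEdge G x y = record
    { Adj = λ a b → Adj G a b × ¬ SameEdge x y a b
    ; adj? = λ a b → adj? G a b ×-dec ¬? (((a ≟V x) ×-dec (b ≟V y)) ⊎-dec ((a ≟V y) ×-dec (b ≟V x)))
    ; symm = λ { (a , ne) → symm G a , λ s → ne (sw s) }
    ; irrefl = λ { (a , _) → irrefl G a } }
    where
    sw : ∀ {a b} → SameEdge x y b a → SameEdge x y a b
    sw (inj₁ (p , q)) = inj₂ (q , p)
    sw (inj₂ (p , q)) = inj₁ (q , p)

NumComponents : {V : Set} → Graph V → ℕ → Set
NumComponents {V} G k = Σ[ L ∈ List V ]
  (length L ≡ k × AllPairs (λ a b → ¬ Reach G a b) L × (∀ v → Any (λ r → Reach G r v) L))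

ComponentOrder : {V : Set} → Graph V → V → ℕ → Set
ComponentOrder {V} G v k = Σ[ L ∈ List V ]
  (Unique L × (∀ w → (w ∈ L) ⇔ Reach G v w) × length L ≡ k)

_≟P_ : {a b : ℕ} → (p q : Fin a × Fin b) → Dec (p ≡ q)
(g , h) ≟P (g' , h') with g ≟ g' | h ≟ h'
... | yes refl | yes refl = yes refl
... | no ne | _ = no λ { refl → ne refl }
... | yes _ | no ne = no λ { refl → ne refl }

CutEdge : {V : Set} → (∀ (a b : V) → Dec (a ≡ b)) → Graph V → V → V → Set
CutEdge eq G x y = Σ[ k ∈ ℕ ] Σ[ k' ∈ ℕ ]
  (NumComponents G k × NumComponents (removeEdge eq G x y) k' × k < k')

{-# OPTIONS --safe #-}
module Submission where

-- Removing the connecting edge (ℓ , f m)(m , f ℓ) at a leaf ℓ of T with neighbour m separates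
-- the copy {ℓ} × V(H), attached to the rest only through this edge, from all other vertices,
-- which stay connected because T − ℓ is connected.
-- Conversely, a component of order n(H) that meets an intact copy of H contains that whole copy
-- and therefore equals it. If the removed edge lies inside the copy of g, the component of an
-- endpoint is thus confined to the copy of g, hence by counting is all of it, yet that copy is
-- still joined to the copy of a neighbour of g (one exists, as the other component is nonempty).
-- If it is the connecting edge of cd, the component of (c , f d) is the copy of c, so a further
-- neighbour w of c, reachable through (c , f w)(w , f c), cannot exist: c is a leaf.

open import Defs
open import Data.Nat using (ℕ; _*_; _∸_; _+_; suc; _≤_; s≤s; z≤n)
open import Data.Nat.Properties using (≤-trans; ≤-reflexive; ≤-antisym; +-suc; <-irrefl; m+n∸m≡n)
open import Data.Fin using (Fin; punchIn) renaming (zero to fzero)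
open import Data.Fin.Properties using (_≟_; punchInᵢ≢i)
open import Data.Product using (∃; _×_; _,_; proj₁; proj₂)
open import Data.Sum using (_⊎_; inj₁; inj₂)
open import Data.List using (List; []; _∷_; length; map; filter; allFin; cartesianProduct)
open import Data.List.Properties using (filter-notAll; length-++; length-map; length-tabulate)
open import Data.List.Membership.Propositional using (_∈_)
open import Data.List.Membership.Propositional.Properties
  using (∈-filter⁺; ∈-filter⁻; ∈-map⁺; ∈-map⁻; ∈-allFin; ∈-cartesianProduct⁺)
import Data.List.Membership.DecPropositional as DecMembership
open import Data.List.Relation.Binary.Subset.Propositional using (_⊆_)
open import Data.List.Relation.Unary.Any using (Any; here; there)
import Data.List.Relation.Unary.Any as Any
import Data.List.Relation.Unary.All as All
open import Data.List.Relation.Unary.All.Properties using (¬Any⇒All¬)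
open import Data.List.Relation.Unary.AllPairs using ([]; _∷_)
import Data.List.Relation.Unary.AllPairs as AllPairs
open import Data.List.Relation.Unary.Unique.Propositional using (Unique)
import Data.List.Relation.Unary.Unique.Propositional.Properties as Unique
open import Function using (_∘_)
open import Function.Bundles using (_⇔_; mk⇔; Equivalence)
open import Relation.Binary.Definitions using (DecidableEquality)
open import Relation.Binary.PropositionalEquality
  using (_≡_; _≢_; refl; sym; trans; cong; cong₂; subst; module ≡-Reasoning)
open import Relation.Nullary using (¬_; yes; no; contradiction)
open import Relation.Unary using (Decidable)
open import Relation.Unary.Properties using (∁?)

module _ {A : Set} (_≟A_ : DecidableEquality A) where
  open DecMembership _≟A_ using (_∈?_)

  Unique-⊆⇒length≤ : ∀ {xs ys : List A} → Unique xs → xs ⊆ ys → length xs ≤ length ys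
  Unique-⊆⇒length≤ {[]}     _                   _       = z≤n
  Unique-⊆⇒length≤ {x ∷ xs} {ys} (x∉xs ∷ xs-unique) x∷xs⊆ys =
    ≤-trans (s≤s (Unique-⊆⇒length≤ xs-unique xs⊆ys∖x)) (filter-notAll (∁? (_≟A x)) ys x∈ys)
    where
    xs⊆ys∖x : xs ⊆ filter (∁? (_≟A x)) ys
    xs⊆ys∖x z∈xs = ∈-filter⁺ (∁? (_≟A x)) (x∷xs⊆ys (there z∈xs)) (λ { refl → All.lookup x∉xs z∈xs refl })
    x∈ys : Any (λ z → ¬ ¬ z ≡ x) ys
    x∈ys = Any.map (λ { refl x≢x → x≢x refl }) (x∷xs⊆ys (here refl))

  Unique-⊆-length≥⇒⊇ : ∀ {xs ys : List A} → Unique xs → xs ⊆ ys → length ys ≤ length xs → ys ⊆ xs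
  Unique-⊆-length≥⇒⊇ {xs} {ys} xs-unique xs⊆ys |ys|≤|xs| {v} v∈ys with v ∈? xs
  ... | yes v∈xs = v∈xs
  ... | no  v∉xs =
    contradiction (≤-trans (Unique-⊆⇒length≤ (¬Any⇒All¬ xs v∉xs ∷ xs-unique) v∷xs⊆ys) |ys|≤|xs|) (<-irrefl refl)
    where
    v∷xs⊆ys : (v ∷ xs) ⊆ ys
    v∷xs⊆ys (here refl)  = v∈ys
    v∷xs⊆ys (there w∈xs) = xs⊆ys w∈xs

  Unique-⊆-antisym⇒length≡ : ∀ {xs ys : List A} → Unique xs → Unique ys → xs ⊆ ys → ys ⊆ xs →
                             length xs ≡ length ys
  Unique-⊆-antisym⇒length≡ xs-unique ys-unique xs⊆ys ys⊆xs =
    ≤-antisym (Unique-⊆⇒length≤ xs-unique xs⊆ys) (Unique-⊆⇒length≤ ys-unique ys⊆xs)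

length-filter+length-filter-∁ : ∀ {A : Set} {P : A → Set} (P? : Decidable P) (xs : List A) →
  length (filter P? xs) + length (filter (∁? P?) xs) ≡ length xs
length-filter+length-filter-∁ P? []       = refl
length-filter+length-filter-∁ P? (x ∷ xs) with P? x
... | yes _ = cong suc (length-filter+length-filter-∁ P? xs)
... | no  _ = trans (+-suc _ _) (cong suc (length-filter+length-filter-∁ P? xs))

length-cartesianProduct : ∀ {A B : Set} (xs : List A) (ys : List B) →
  length (cartesianProduct xs ys) ≡ length xs * length ys
length-cartesianProduct []       ys = refl
length-cartesianProduct (x ∷ xs) ys =
  trans (length-++ (map (x ,_) ys)) (cong₂ _+_ (length-map (x ,_) ys) (length-cartesianProduct xs ys))

Adj⇒≢ : ∀ {V : Set} (G : Graph V) {a b : V} → Adj G a b → a ≢ b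
Adj⇒≢ G ab refl = irrefl G ab

module _ {V : Set} {G : Graph V} where

  infixr 5 _◅◅_
  _◅◅_ : ∀ {a b c} → Reach G a b → Reach G b c → Reach G a c
  here       ◅◅ r = r
  step ab bc ◅◅ r = step ab (bc ◅◅ r)

  Reach-preserves : (P : V → Set) → (∀ {a b} → Adj G a b → P a → P b) → ∀ {a b} → Reach G a b → P a → P b
  Reach-preserves P adj-pres here         pa = pa
  Reach-preserves P adj-pres (step ab bc) pa = Reach-preserves P adj-pres bc (adj-pres ab pa)

  Reach⇒neighbour : ∀ {a b} → Reach G a b → a ≢ b → ∃ (Adj G a)
  Reach⇒neighbour here        a≢a = contradiction refl a≢a
  Reach⇒neighbour (step ab _) _   = _ , ab

  connected⇒one-component : Connected G → V → NumComponents G 1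
  connected⇒one-component conn x = x ∷ [] , refl , All.[] ∷ [] , λ v → here (conn x v)

  component-nonempty : ∀ {z} → ¬ ComponentOrder G z 0
  component-nonempty {z} ([] , _ , ∈⇔ , _) with Equivalence.from (∈⇔ z) here
  ... | ()

Reach-map : ∀ {V W : Set} {G : Graph V} {K : Graph W} (φ : V → W) →
  (∀ {a b} → Adj G a b → Adj K (φ a) (φ b)) → ∀ {a b} → Reach G a b → Reach K (φ a) (φ b)
Reach-map φ adj-map here         = here
Reach-map φ adj-map (step ab bc) = step (adj-map ab) (Reach-map φ adj-map bc)

neighbour⊎singleton : ∀ {n} (G : Graph (Fin n)) → Connected G → (g : Fin n) → ∃ (Adj G g) ⊎ n ≡ 1
neighbour⊎singleton {suc 0}       G conn g = inj₂ refl
neighbour⊎singleton {suc (suc n)} G conn g =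
  inj₁ (Reach⇒neighbour (conn g (punchIn g fzero)) (punchInᵢ≢i g fzero ∘ sym))

module _ {V : Set} {G K : Graph V}
         (G⇒K : ∀ {a b} → Reach G a b → Reach K a b) (K⇒G : ∀ {a b} → Reach K a b → Reach G a b) where

  ComponentOrder-transfer : ∀ {z k} → ComponentOrder G z k → ComponentOrder K z k
  ComponentOrder-transfer (L , L-unique , ∈⇔ , |L|≡k) =
    L , L-unique , (λ w → mk⇔ (G⇒K ∘ Equivalence.to (∈⇔ w)) (Equivalence.from (∈⇔ w) ∘ K⇒G)) , |L|≡k

  NumComponents-transfer : ∀ {k} → NumComponents G k → NumComponents K k
  NumComponents-transfer (L , |L|≡k , apart , cover) =
    L , |L|≡k , AllPairs.map (_∘ K⇒G) apart , λ v → Any.map G⇒K (cover v)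

SameEdge-swap : ∀ {V : Set} {x y a b : V} → SameEdge x y a b → SameEdge y x a b
SameEdge-swap (inj₁ e) = inj₂ e
SameEdge-swap (inj₂ e) = inj₁ e

SameEdge-map : ∀ {V W : Set} (φ : V → W) {x y a b : V} → SameEdge x y a b → SameEdge (φ x) (φ y) (φ a) (φ b)
SameEdge-map φ (inj₁ (refl , refl)) = inj₁ (refl , refl)
SameEdge-map φ (inj₂ (refl , refl)) = inj₂ (refl , refl)

SameEdge-avoids : ∀ {V : Set} {x y a b : V} → a ≢ x → b ≢ x → ¬ SameEdge x y a b
SameEdge-avoids a≢x b≢x (inj₁ (a≡x , _)) = a≢x a≡x
SameEdge-avoids a≢x b≢x (inj₂ (_ , b≡x)) = b≢x b≡x

SameEdge-loop : ∀ {V : Set} {x y a : V} → x ≢ y → ¬ SameEdge x y a a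
SameEdge-loop x≢y (inj₁ (a≡x , a≡y)) = x≢y (trans (sym a≡x) a≡y)
SameEdge-loop x≢y (inj₂ (a≡y , a≡x)) = x≢y (trans (sym a≡x) a≡y)

SameEdge-degenerate : ∀ {V : Set} {x a b : V} → a ≢ b → ¬ SameEdge x x a b
SameEdge-degenerate a≢b (inj₁ (a≡x , b≡x)) = a≢b (trans a≡x (sym b≡x))
SameEdge-degenerate a≢b (inj₂ (a≡x , b≡x)) = a≢b (trans a≡x (sym b≡x))

module _ {V : Set} (_≟V_ : DecidableEquality V) (G : Graph V) where

  removeEdge-swap : ∀ {x y a b} → Reach (removeEdge _≟V_ G x y) a b → Reach (removeEdge _≟V_ G y x) a b
  removeEdge-swap = Reach-map (λ a → a) (λ (ab , ab≉xy) → ab , ab≉xy ∘ SameEdge-swap)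

  CutEdge-swap : ∀ {x y} → CutEdge _≟V_ G x y → CutEdge _≟V_ G y x
  CutEdge-swap {x} {y} (k , k' , G-comps , G∖xy-comps , k<k') =
    k , k' , G-comps , NumComponents-transfer (removeEdge-swap {x} {y}) (removeEdge-swap {y} {x}) G∖xy-comps , k<k'

  ComponentOrder-swap : ∀ {x y z k} → ComponentOrder (removeEdge _≟V_ G x y) z k →
                        ComponentOrder (removeEdge _≟V_ G y x) z k
  ComponentOrder-swap {x} {y} = ComponentOrder-transfer (removeEdge-swap {x} {y}) (removeEdge-swap {y} {x})

module SierpinskiProduct {nT nH : ℕ} (T : Graph (Fin nT)) (H : Graph (Fin nH)) (f : Fin nT → Fin nH) where

  V : Set
  V = Fin nT × Fin nH

  G : Graph V
  G = Sierpinski T H f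

  G∖[_,_] : V → V → Graph V
  G∖[ x , y ] = removeEdge _≟P_ G x y

  CopyAndComplement : Graph V → V → V → Set
  CopyAndComplement K u v = ComponentOrder K u nH × ComponentOrder K v (nT * nH ∸ nH)

  CutsOffCopy : V → V → Set
  CutsOffCopy x y = CutEdge _≟P_ G x y × (CopyAndComplement G∖[ x , y ] x y ⊎ CopyAndComplement G∖[ x , y ] y x)

  CopyAndComplement-swap : ∀ {x y u v} → CopyAndComplement G∖[ x , y ] u v → CopyAndComplement G∖[ y , x ] u v
  CopyAndComplement-swap (Cu , Cv) = ComponentOrder-swap _≟P_ G Cu , ComponentOrder-swap _≟P_ G Cv

  CutsOffCopy-swap : ∀ {x y} → CutsOffCopy x y → CutsOffCopy y x
  CutsOffCopy-swap (cut , inj₁ x-copy) = CutEdge-swap _≟P_ G cut , inj₂ (CopyAndComplement-swap x-copy)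
  CutsOffCopy-swap (cut , inj₂ y-copy) = CutEdge-swap _≟P_ G cut , inj₁ (CopyAndComplement-swap y-copy)

  PendantConnecting-swap : ∀ {x y} → PendantConnecting T H f x y → PendantConnecting T H f y x
  PendantConnecting-swap (u , v , uv , leaf , inj₁ (x≡ , y≡)) = u , v , uv , leaf , inj₂ (y≡ , x≡)
  PendantConnecting-swap (u , v , uv , leaf , inj₂ (x≡ , y≡)) = u , v , uv , leaf , inj₁ (y≡ , x≡)

  copy : Fin nT → List V
  copy a = map (a ,_) (allFin nH)

  copy-unique : ∀ a → Unique (copy a)
  copy-unique a = Unique.map⁺ (λ { refl → refl }) (Unique.allFin⁺ nH)

  length-copy : ∀ a → length (copy a) ≡ nH
  length-copy a = trans (length-map (a ,_) (allFin nH)) (length-tabulate (λ i → i))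

  ∈-copy⁺ : ∀ {a w} → proj₁ w ≡ a → w ∈ copy a
  ∈-copy⁺ {w = a , h} refl = ∈-map⁺ (a ,_) (∈-allFin h)

  ∈-copy⁻ : ∀ {a w} → w ∈ copy a → proj₁ w ≡ a
  ∈-copy⁻ w∈ with ∈-map⁻ (_ ,_) w∈
  ... | _ , _ , refl = refl

  vertices : List V
  vertices = cartesianProduct (allFin nT) (allFin nH)

  vertices-unique : Unique vertices
  vertices-unique = Unique.cartesianProduct⁺ (Unique.allFin⁺ nT) (Unique.allFin⁺ nH)

  ∈-vertices : ∀ w → w ∈ vertices
  ∈-vertices (a , h) = ∈-cartesianProduct⁺ (∈-allFin a) (∈-allFin h)

  length-vertices : length vertices ≡ nT * nH
  length-vertices = trans (length-cartesianProduct (allFin nT) (allFin nH))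
    (cong₂ _*_ (length-tabulate {n = nT} (λ i → i)) (length-tabulate {n = nH} (λ i → i)))

  in-copy? : ∀ a → Decidable (λ (w : V) → proj₁ w ≡ a)
  in-copy? a w = proj₁ w ≟ a

  outside : Fin nT → List V
  outside a = filter (∁? (in-copy? a)) vertices

  length-outside : ∀ a → length (outside a) ≡ nT * nH ∸ nH
  length-outside a = trans (sym (m+n∸m≡n nH _)) (cong (_∸ nH) copy+outside)
    where
    open ≡-Reasoning
    inside : List V
    inside = filter (in-copy? a) vertices
    |inside|≡nH : length inside ≡ nH
    |inside|≡nH = trans
      (Unique-⊆-antisym⇒length≡ _≟P_ (Unique.filter⁺ (in-copy? a) vertices-unique) (copy-unique a)
        (∈-copy⁺ ∘ proj₂ ∘ ∈-filter⁻ (in-copy? a) {xs = vertices})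
        (λ {w} w∈ → ∈-filter⁺ (in-copy? a) (∈-vertices w) (∈-copy⁻ w∈)))
      (length-copy a)
    copy+outside : nH + length (outside a) ≡ nT * nH
    copy+outside = begin
      nH + length (outside a)                 ≡⟨ cong (_+ length (outside a)) |inside|≡nH ⟨
      length inside + length (outside a)      ≡⟨ length-filter+length-filter-∁ (in-copy? a) vertices ⟩
      length vertices                         ≡⟨ length-vertices ⟩
      nT * nH                                 ∎

  copy-edge : ∀ {a h h'} → Adj H h h' → Adj G (a , h) (a , h')
  copy-edge hh' = inj₁ (refl , hh')

  connecting-edge : ∀ {a b} → Adj T a b → Adj G (a , f b) (b , f a)
  connecting-edge ab = inj₂ (ab , refl , refl)

  survives : ∀ {x y u v} → Adj G u v → ¬ SameEdge (proj₁ x) (proj₁ y) (proj₁ u) (proj₁ v) → Adj G∖[ x , y ] u v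
  survives uv uv≉xy = uv , uv≉xy ∘ SameEdge-map proj₁

  CopyIntact : Graph V → Fin nT → Set
  CopyIntact K a = ∀ {h h'} → Adj H h h' → Adj K (a , h) (a , h')

  module _ (Hc : Connected H) {K : Graph V} where

    within-copy : ∀ {a} → CopyIntact K a → ∀ h h' → Reach K (a , h) (a , h')
    within-copy {a} intact h h' = Reach-map (a ,_) intact (Hc h h')

    reach-next-copy : ∀ {a b z} → CopyIntact K b → Adj K (a , f b) (b , f a) → Reach K z (a , f b) →
                      ∀ h → Reach K z (b , h)
    reach-next-copy {a} intact ab z→a h = z→a ◅◅ step ab (within-copy intact (f a) h)

    component-within-copy : ∀ {a z h} → CopyIntact K a → ComponentOrder K z nH → Reach K z (a , h) →
                            ∀ {w} → Reach K z w → proj₁ w ≡ a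
    component-within-copy {a} {h = h} intact (L , L-unique , ∈L⇔ , |L|≡nH) z→a z→w =
      ∈-copy⁻ (L⊆copy (Equivalence.from (∈L⇔ _) z→w))
      where
      copy⊆L : copy a ⊆ L
      copy⊆L {_ , h'} w∈ with refl ← ∈-copy⁻ w∈ = Equivalence.from (∈L⇔ _) (z→a ◅◅ within-copy intact h h')
      L⊆copy : L ⊆ copy a
      L⊆copy = Unique-⊆-length≥⇒⊇ _≟P_ (copy-unique a) copy⊆L (≤-reflexive (trans |L|≡nH (sym (length-copy a))))

  Sierpinski-connected : Connected T → Connected H → Connected G
  Sierpinski-connected Tc Hc x (b , h) =
    Reach-preserves (λ a → ∀ h → Reach G x (a , h)) extend (Tc (proj₁ x) b) (within-copy Hc copy-edge (proj₂ x)) h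
    where
    extend : ∀ {a b} → Adj T a b → (∀ h → Reach G x (a , h)) → ∀ h → Reach G x (b , h)
    extend ab x→a = reach-next-copy Hc copy-edge (connecting-edge ab) (x→a _)

  module PendantEdge (Tc : Connected T) (Hc : Connected H) {ℓ m : Fin nT}
                     (ℓm : Adj T ℓ m) (neighbour≡m : ∀ {w} → Adj T ℓ w → w ≡ m) where

    p q : V
    p = ℓ , f m
    q = m , f ℓ

    K : Graph V
    K = G∖[ p , q ]

    m≢ℓ : m ≢ ℓ
    m≢ℓ = Adj⇒≢ T ℓm ∘ sym

    stays-in-copy-ℓ : ∀ {u v} → Adj K u v → proj₁ u ≡ ℓ → proj₁ v ≡ ℓ
    stays-in-copy-ℓ (inj₁ (refl , _) , _) u∈ℓ = u∈ℓ
    stays-in-copy-ℓ (inj₂ (ℓb , refl , refl) , uv≉pq) refl with refl ← neighbour≡m ℓb =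
      contradiction (inj₁ (refl , refl)) uv≉pq

    stays-outside-ℓ : ∀ {u v} → Adj K u v → proj₁ u ≢ ℓ → proj₁ v ≢ ℓ
    stays-outside-ℓ uv u∉ℓ = u∉ℓ ∘ stays-in-copy-ℓ (symm K uv)

    outside-intact : ∀ {a} → a ≢ ℓ → CopyIntact K a
    outside-intact a≢ℓ hh' = survives (copy-edge hh') (SameEdge-avoids a≢ℓ a≢ℓ)

    p-reaches : ∀ {w} → proj₁ w ≡ ℓ → Reach K p w
    p-reaches {_ , h} refl = within-copy Hc (λ hh' → survives (copy-edge hh') (SameEdge-loop (m≢ℓ ∘ sym))) (f m) h

    -- Along a walk from m in T, the only step leaving ℓ leads back to m.
    q-reaches : ∀ {w} → proj₁ w ≢ ℓ → Reach K q w
    q-reaches {a , h} a≢ℓ = Reach-preserves Reached extend (Tc m a) (λ _ → q-reaches-copy-m) a≢ℓ h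
      where
      Reached : Fin nT → Set
      Reached b = b ≢ ℓ → ∀ h → Reach K q (b , h)
      q-reaches-copy-m : ∀ h → Reach K q (m , h)
      q-reaches-copy-m = within-copy Hc (outside-intact m≢ℓ) (f ℓ)
      extend : ∀ {b c} → Adj T b c → Reached b → Reached c
      extend {b} bc q→b c≢ℓ with b ≟ ℓ
      ... | yes refl rewrite neighbour≡m bc = q-reaches-copy-m
      ... | no  b≢ℓ =
        reach-next-copy Hc (outside-intact c≢ℓ) (survives (connecting-edge bc) (SameEdge-avoids b≢ℓ c≢ℓ)) (q→b b≢ℓ _)

    p-component : ComponentOrder K p nH
    p-component = copy ℓ , copy-unique ℓ ,
      (λ w → mk⇔ (p-reaches ∘ ∈-copy⁻) (λ p→w → ∈-copy⁺ (Reach-preserves _ stays-in-copy-ℓ p→w refl))) ,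
      length-copy ℓ

    q-component : ComponentOrder K q (nT * nH ∸ nH)
    q-component = outside ℓ , Unique.filter⁺ (∁? (in-copy? ℓ)) vertices-unique ,
      (λ w → mk⇔ (q-reaches ∘ proj₂ ∘ ∈-filter⁻ (∁? (in-copy? ℓ)) {xs = vertices})
                 (λ q→w → ∈-filter⁺ (∁? (in-copy? ℓ)) (∈-vertices w) (Reach-preserves _ stays-outside-ℓ q→w m≢ℓ))) ,
      length-outside ℓ

    two-components : NumComponents K 2
    two-components = p ∷ q ∷ [] , refl , ((p↛q All.∷ All.[]) ∷ All.[] ∷ []) , cover
      where
      p↛q : ¬ Reach K p q
      p↛q p→q = m≢ℓ (Reach-preserves _ stays-in-copy-ℓ p→q refl)
      cover : ∀ w → Any (λ r → Reach K r w) (p ∷ q ∷ [])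
      cover (a , h) with a ≟ ℓ
      ... | yes a≡ℓ = here (p-reaches a≡ℓ)
      ... | no  a≢ℓ = there (here (q-reaches a≢ℓ))

  pendant-cuts-off-copy : Connected T → Connected H → ∀ {ℓ m} → Adj T ℓ m → Degree1 T ℓ →
                          CutsOffCopy (ℓ , f m) (m , f ℓ)
  pendant-cuts-off-copy Tc Hc {ℓ} {m} ℓm (_ , _ , ℓ-leaf) =
    (1 , 2 , connected⇒one-component (Sierpinski-connected Tc Hc) p , two-components , s≤s (s≤s z≤n)) ,
    inj₁ (p-component , q-component)
    where
    open PendantEdge Tc Hc ℓm (λ ℓw → trans (ℓ-leaf _ ℓw) (sym (ℓ-leaf m ℓm)))

  module _ (Hc : Connected H) where

    damaged-copy⇒¬order-nH : ∀ {K g b z} → (∀ {a} → a ≢ g → CopyIntact K a) →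
      (∀ {a c} → Adj T a c → Adj K (a , f c) (c , f a)) → Adj T g b → proj₁ z ≡ g → ¬ ComponentOrder K z nH
    damaged-copy⇒¬order-nH {K} {g} {b} {z} intact connecting gb z∈g C@(L , L-unique , ∈L⇔ , |L|≡nH) =
      Adj⇒≢ T gb (sym (in-copy-g (z→gfb ◅◅ step (connecting gb) here)))
      where
      in-copy-g : ∀ {w} → Reach K z w → proj₁ w ≡ g
      in-copy-g {w} z→w with proj₁ w ≟ g
      ... | yes w∈g = w∈g
      ... | no  w∉g = trans (sym (component-within-copy Hc (intact w∉g) C z→w here)) z∈g
      copy-g⊆L : copy g ⊆ L
      copy-g⊆L = Unique-⊆-length≥⇒⊇ _≟P_ L-unique (∈-copy⁺ ∘ in-copy-g ∘ Equivalence.to (∈L⇔ _))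
        (≤-reflexive (trans (length-copy g) (sym |L|≡nH)))
      z→gfb : Reach K z (g , f b)
      z→gfb = Equivalence.to (∈L⇔ _) (copy-g⊆L (∈-copy⁺ refl))

    order-nH-component⇒leaf : ∀ {K c d} → Adj T c d → CopyIntact K c →
      (∀ {w} → Adj T c w → w ≢ d → Adj K (c , f w) (w , f c)) → ComponentOrder K (c , f d) nH → Degree1 T c
    order-nH-component⇒leaf {K} {c} {d} cd intact connecting C = d , cd , neighbour≡d
      where
      neighbour≡d : ∀ w → Adj T c w → w ≡ d
      neighbour≡d w cw with w ≟ d
      ... | yes w≡d = w≡d
      ... | no  w≢d = contradiction (component-within-copy Hc intact C here c→w) (Adj⇒≢ T cw ∘ sym)
        where
        c→w : Reach K (c , f d) (w , f c)
        c→w = within-copy Hc intact (f d) (f w) ◅◅ step (connecting cw w≢d) here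

  copy-and-complement⇒pendant : Connected T → Connected H → ∀ {x y} → Adj G x y →
    CopyAndComplement G∖[ x , y ] x y → PendantConnecting T H f x y
  copy-and-complement⇒pendant Tc Hc {g , h} {_ , h'} (inj₁ (refl , _)) (Cx , Cy) with neighbour⊎singleton T Tc g
  ... | inj₁ (b , gb) = contradiction Cx (damaged-copy⇒¬order-nH Hc other-copies-intact connecting-intact gb refl)
    where
    other-copies-intact : ∀ {a} → a ≢ g → CopyIntact G∖[ (g , h) , (g , h') ] a
    other-copies-intact a≢g hh' = survives (copy-edge hh') (SameEdge-avoids a≢g a≢g)
    connecting-intact : ∀ {a c} → Adj T a c → Adj G∖[ (g , h) , (g , h') ] (a , f c) (c , f a)
    connecting-intact ac = survives (connecting-edge ac) (SameEdge-degenerate (Adj⇒≢ T ac))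
  ... | inj₂ nT≡1 = contradiction (subst (ComponentOrder _ _) complement-empty Cy) component-nonempty
    where
    complement-empty : nT * nH ∸ nH ≡ 0
    complement-empty = trans (cong (λ n → n * nH ∸ nH) nT≡1) (m+n∸m≡n nH 0)
  copy-and-complement⇒pendant Tc Hc {c , _} {d , _} (inj₂ (cd , refl , refl)) (Cx , _) =
    c , d , cd , inj₁ (order-nH-component⇒leaf Hc cd copy-c-intact other-edges-intact Cx) , inj₁ (refl , refl)
    where
    copy-c-intact : CopyIntact G∖[ (c , f d) , (d , f c) ] c
    copy-c-intact hh' = survives (copy-edge hh') (SameEdge-loop (Adj⇒≢ T cd))
    other-edges-intact : ∀ {w} → Adj T c w → w ≢ d → Adj G∖[ (c , f d) , (d , f c) ] (c , f w) (w , f c)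
    other-edges-intact cw w≢d = survives (connecting-edge cw) λ where
      (inj₁ (_ , w≡d)) → w≢d w≡d
      (inj₂ (c≡d , _)) → Adj⇒≢ T cd c≡d

lemma5p1 : {nT nH : ℕ} (T : Graph (Fin nT)) (H : Graph (Fin nH)) (f : Fin nT → Fin nH) →
    IsTree T → Connected H →
    (x y : Fin nT × Fin nH) → Adj (Sierpinski T H f) x y →
    PendantConnecting T H f x y ⇔
      (CutEdge _≟P_ (Sierpinski T H f) x y ×
        ((ComponentOrder (removeEdge _≟P_ (Sierpinski T H f) x y) x nH
            × ComponentOrder (removeEdge _≟P_ (Sierpinski T H f) x y) y (nT * nH ∸ nH))
         ⊎ (ComponentOrder (removeEdge _≟P_ (Sierpinski T H f) x y) y nH
            × ComponentOrder (removeEdge _≟P_ (Sierpinski T H f) x y) x (nT * nH ∸ nH))))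
lemma5p1 T H f (Tc , _) Hc x y xy = mk⇔ forward backward
  where
  open SierpinskiProduct T H f

  forward : PendantConnecting T H f x y → CutsOffCopy x y
  forward (u , v , uv , inj₁ u-leaf , inj₁ (refl , refl)) = pendant-cuts-off-copy Tc Hc uv u-leaf
  forward (u , v , uv , inj₁ u-leaf , inj₂ (refl , refl)) =
    CutsOffCopy-swap (pendant-cuts-off-copy Tc Hc uv u-leaf)
  forward (u , v , uv , inj₂ v-leaf , inj₁ (refl , refl)) =
    CutsOffCopy-swap (pendant-cuts-off-copy Tc Hc (symm T uv) v-leaf)
  forward (u , v , uv , inj₂ v-leaf , inj₂ (refl , refl)) = pendant-cuts-off-copy Tc Hc (symm T uv) v-leaf

  backward : CutsOffCopy x y → PendantConnecting T H f x y
  backward (_ , inj₁ x-copy) = copy-and-complement⇒pendant Tc Hc xy x-copy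
  backward (_ , inj₂ y-copy) =
    PendantConnecting-swap (copy-and-complement⇒pendant Tc Hc (symm G xy) (CopyAndComplement-swap y-copy))
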